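{- Let $m\geq 1$, $D=\{1,\ldots,m\}$, and let $X$ be the set of pairs $(i,\chi)$ with $i\in D$ and $\chi\colon D\to\{0,1\}$. Let $\Gamma$ be the group of permutations of $X$ generated by all $\alpha^F$ with $F\subseteq D^2$ symmetric and all $\alpha_\psi$ with $\psi$ a permutation of $D$. Then for every $g\in\Gamma$ there exist a permutation $\psi$ of $D$ and a symmetric set $F\subseteq D^2$ such that $g=\alpha_\psi\circ\alpha^F$.
   Context: A function $\chi\colon D\to\{0,1\}$ is a valuation function. For $F'\subseteq D$, the flip $\chi^{F'}\colon D\to\{0,1\}$ is defined by $\chi^{F'}(i)=1-\chi(i)$ if $i\in F'$ and $\chi^{F'}(i)=\chi(i)$ otherwise. For a permutation $\psi$ of $D$, $\chi_\psi$ is defined by $\chi_\psi(i)=\chi(\psi^{ -1}(i))$. A set $F\subseteq D^2$ is symmetric if $(i,j)\in F$ implies $(j,i)\in F$; for such $F$ and $i\in D$ let $F_i=\{j\in D:(i,j)\in F\}$. Then $\alpha^F$ is the permutation of $X$ given by $(i,\chi)\mapsto(i,\chi^{F_i})$, and $\alpha_\psi$ is the permutation of $X$ given by $(i,\chi)\mapsto(\psi(i),\chi_\psi)$. (In the paper these act on unary relation symbols $U^\chi_i$ of a language, fixing all other symbols.) Composition $\alpha_\psi\circ\alpha^F$ means first applying $\alpha^F$. -}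

module Defs where

open import Data.Nat using (ℕ)
open import Data.Bool using (Bool; not; if_then_else_)
open import Data.Fin using (Fin)
open import Data.Fin.Permutation using (Permutation′; _⟨$⟩ʳ_; _⟨$⟩ˡ_)
open import Data.Product using (Σ; _×_; _,_; proj₁; proj₂)
open import Relation.Binary.PropositionalEquality using (_≡_)
open import Function using (_∘_; id)

-- D = Fin m, valuation functions χ : D → {0,1} rendered as Fin m → Bool
Val : ℕ → Set
Val m = Fin m → Bool

X : ℕ → Set
X m = Fin m × Val m

-- equality on X: same index, pointwise-equal valuations (no funext in Agda)
_≈X_ : ∀ {m} → X m → X m → Set
(i , χ) ≈X (j , χ′) = (i ≡ j) × (∀ k → χ k ≡ χ′ k)

Rel2 : ℕ → Set
Rel2 m = Fin m → Fin m → Bool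

Symmetric : ∀ {m} → Rel2 m → Set
Symmetric {m} F = ∀ (i j : Fin m) → F i j ≡ F j i

flipV : ∀ {m} → (Fin m → Bool) → Val m → Val m
flipV F′ χ k = if F′ k then not (χ k) else χ k

permV : ∀ {m} → Permutation′ m → Val m → Val m
permV ψ χ i = χ (ψ ⟨$⟩ˡ i)

αF : ∀ {m} → Rel2 m → X m → X m
αF F (i , χ) = i , flipV (F i) χ

αψ : ∀ {m} → Permutation′ m → X m → X m
αψ ψ (i , χ) = (ψ ⟨$⟩ʳ i) , permV ψ χ

-- A pair (g , h) ∈ InΓ means g ∈ Γ with inverse h.
data InΓ {m : ℕ} : (X m → X m) → (X m → X m) → Set where
  gen-F    : ∀ (F : Rel2 m) → Symmetric F → InΓ (αF F) (αF F)
  gen-ψ    : ∀ (ψ : Permutation′ m) →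
             InΓ (αψ ψ) (λ { (i , χ) → (ψ ⟨$⟩ˡ i) , (λ k → χ (ψ ⟨$⟩ʳ k)) })
  γ-id     : InΓ id id
  γ-inv    : ∀ {g h} → InΓ g h → InΓ h g
  γ-comp   : ∀ {g g′ h h′} → InΓ g g′ → InΓ h h′ → InΓ (g ∘ h) (h′ ∘ g′)

module Submission where

-- Call g : X → X *normal* if g agrees pointwise with α_ψ ∘ α^F for some
-- permutation ψ and symmetric F.  The generators and the identity are normal,
-- and a derivation of g ∈ Γ carries the inverse of g along, so by induction
-- on that derivation it suffices to show that normal maps are closed under
-- composition.  This follows from three relations between the generators:
--   (R1) α^F ∘ α^G = α^{G ⊕ F}          (flips add up modulo 2),
--   (R2) α^F ∘ α_φ = α_φ ∘ α^{F^φ}       (F^φ(i,j) = F(φ i, φ j)),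
--   (R3) α_ψ ∘ α_φ = α_{ψ∘φ},
-- which rewrite α_ψ α^F α_φ α^G into α_{ψ∘φ} α^{G ⊕ F^φ}; the relation
-- G ⊕ F^φ is symmetric when F and G are.

open import Defs
open import Data.Nat using (ℕ; _≥_)
open import Data.Fin using (Fin)
open import Data.Fin.Permutation
  using (Permutation′; _⟨$⟩ʳ_; _⟨$⟩ˡ_; _∘ₚ_; flip; inverseʳ)
import Data.Fin.Permutation as Perm
open import Data.Bool using (Bool; true; false; not; if_then_else_; _xor_)
open import Data.Bool.Properties using (xor-assoc; xor-comm)
open import Data.Product using (Σ; _×_; _,_; proj₁)
open import Function using (_∘_)
open import Relation.Binary.PropositionalEquality
  using (_≡_; refl; sym; trans; cong; cong₂; module ≡-Reasoning)

≈X-refl : ∀ {m} (x : X m) → x ≈X x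
≈X-refl (i , χ) = refl , λ _ → refl

≈X-trans : ∀ {m} {x y z : X m} → x ≈X y → y ≈X z → x ≈X z
≈X-trans {x = _ , _} {_ , _} {_ , _} (i≡j , χ≗χ′) (j≡k , χ′≗χ″) =
  trans i≡j j≡k , λ k → trans (χ≗χ′ k) (χ′≗χ″ k)

module ≈X-Reasoning {m : ℕ} where
  infixr 2 _≈⟨_⟩_
  infix  3 _∎

  _≈⟨_⟩_ : ∀ (x : X m) {y z} → x ≈X y → y ≈X z → x ≈X z
  _ ≈⟨ x≈y ⟩ y≈z = ≈X-trans x≈y y≈z

  _∎ : ∀ (x : X m) → x ≈X x
  _∎ = ≈X-refl

Normal : ∀ {m} → (X m → X m) → Set
Normal {m} g = Σ (Permutation′ m) λ ψ → Σ (Rel2 m) λ F →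
  Symmetric F × (∀ (x : X m) → g x ≈X (αψ ψ ∘ αF F) x)

_⊕_ : ∀ {m} → Rel2 m → Rel2 m → Rel2 m
(F ⊕ G) i j = F i j xor G i j

_^_ : ∀ {m} → Rel2 m → Permutation′ m → Rel2 m
(F ^ φ) i j = F (φ ⟨$⟩ʳ i) (φ ⟨$⟩ʳ j)

⊕-symmetric : ∀ {m} {F G : Rel2 m} → Symmetric F → Symmetric G → Symmetric (F ⊕ G)
⊕-symmetric sF sG i j = cong₂ _xor_ (sF i j) (sG i j)

^-symmetric : ∀ {m} {F : Rel2 m} (φ : Permutation′ m) → Symmetric F → Symmetric (F ^ φ)
^-symmetric φ sF i j = sF (φ ⟨$⟩ʳ i) (φ ⟨$⟩ʳ j)

∅ : ∀ {m} → Rel2 m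
∅ _ _ = false

flip-bit≡xor : ∀ b c → (if b then not c else c) ≡ b xor c
flip-bit≡xor true  c = refl
flip-bit≡xor false c = refl

flipV-flipV : ∀ {m} (A B : Fin m → Bool) (χ : Val m) k →
  flipV A (flipV B χ) k ≡ flipV (λ j → B j xor A j) χ k
flipV-flipV A B χ k = begin
  flipV A (flipV B χ) k        ≡⟨ flip-bit≡xor (A k) _ ⟩
  A k xor flipV B χ k          ≡⟨ cong (A k xor_) (flip-bit≡xor (B k) (χ k)) ⟩
  A k xor (B k xor χ k)        ≡⟨ sym (xor-assoc (A k) (B k) (χ k)) ⟩
  (A k xor B k) xor χ k        ≡⟨ cong (_xor χ k) (xor-comm (A k) (B k)) ⟩
  (B k xor A k) xor χ k        ≡⟨ sym (flip-bit≡xor (B k xor A k) (χ k)) ⟩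
  flipV (λ j → B j xor A j) χ k ∎
  where open ≡-Reasoning

αF-αF : ∀ {m} (F G : Rel2 m) (x : X m) → αF F (αF G x) ≈X αF (G ⊕ F) x
αF-αF F G (i , χ) = refl , flipV-flipV (F i) (G i) χ

αF-αψ : ∀ {m} (F : Rel2 m) (φ : Permutation′ m) (x : X m) →
  αF F (αψ φ x) ≈X αψ φ (αF (F ^ φ) x)
αF-αψ F φ (i , χ) = refl , λ k →
  cong (λ j → if F (φ ⟨$⟩ʳ i) j then not (χ (φ ⟨$⟩ˡ k)) else χ (φ ⟨$⟩ˡ k))
       (sym (inverseʳ φ))

-- (R3) Permutations compose (φ ∘ₚ ψ is "first φ, then ψ").
αψ-αψ : ∀ {m} (ψ φ : Permutation′ m) (x : X m) → αψ ψ (αψ φ x) ≈X αψ (φ ∘ₚ ψ) x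
αψ-αψ ψ φ (i , χ) = refl , λ k → refl

αF-cong : ∀ {m} (F : Rel2 m) {x y : X m} → x ≈X y → αF F x ≈X αF F y
αF-cong F {i , _} {.i , _} (refl , χ≗χ′) =
  refl , λ k → cong (λ b → if F i k then not b else b) (χ≗χ′ k)

αψ-cong : ∀ {m} (ψ : Permutation′ m) {x y : X m} → x ≈X y → αψ ψ x ≈X αψ ψ y
αψ-cong ψ {i , _} {.i , _} (refl , χ≗χ′) = refl , λ k → χ≗χ′ (ψ ⟨$⟩ˡ k)

normal-∘ : ∀ {m} {g h : X m → X m} → Normal g → Normal h → Normal (g ∘ h)
normal-∘ {g = g} {h} (ψ , F , sF , g≈) (φ , G , sG , h≈) =
  φ ∘ₚ ψ , G ⊕ (F ^ φ) , ⊕-symmetric sG (^-symmetric φ sF) , λ x →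
    g (h x)                                 ≈⟨ g≈ (h x) ⟩
    αψ ψ (αF F (h x))                       ≈⟨ αψ-cong ψ (αF-cong F (h≈ x)) ⟩
    αψ ψ (αF F (αψ φ (αF G x)))             ≈⟨ αψ-cong ψ (αF-αψ F φ (αF G x)) ⟩
    αψ ψ (αψ φ (αF (F ^ φ) (αF G x)))       ≈⟨ αψ-αψ ψ φ (αF (F ^ φ) (αF G x)) ⟩
    αψ (φ ∘ₚ ψ) (αF (F ^ φ) (αF G x))       ≈⟨ αψ-cong (φ ∘ₚ ψ) (αF-αF (F ^ φ) G x) ⟩
    αψ (φ ∘ₚ ψ) (αF (G ⊕ (F ^ φ)) x)        ∎
  where open ≈X-Reasoning

αF-normal : ∀ {m} (F : Rel2 m) → Symmetric F → Normal (αF F)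
αF-normal F sF = Perm.id , F , sF , λ { (i , χ) → refl , λ _ → refl }

αψ-normal : ∀ {m} (ψ : Permutation′ m) → Normal (αψ ψ)
αψ-normal ψ = ψ , ∅ , (λ _ _ → refl) , λ { (i , χ) → refl , λ _ → refl }

normal-resp : ∀ {m} {g g′ : X m → X m} → (∀ x → g x ≈X g′ x) → Normal g′ → Normal g
normal-resp g≈g′ (ψ , F , sF , g′≈) = ψ , F , sF , λ x → ≈X-trans (g≈g′ x) (g′≈ x)

Γ-normal : ∀ {m} {g h : X m → X m} → InΓ g h → Normal g × Normal h
Γ-normal (gen-F F sF)   = αF-normal F sF , αF-normal F sF
Γ-normal (gen-ψ ψ)      =
  αψ-normal ψ , normal-resp (λ { (i , χ) → refl , λ _ → refl }) (αψ-normal (flip ψ))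
Γ-normal γ-id           = id-normal , id-normal
  where
    id-normal : Normal (λ x → x)
    id-normal = normal-resp (λ { (i , χ) → refl , λ _ → refl }) (αψ-normal Perm.id)
Γ-normal (γ-inv p)      with Γ-normal p
... | g-normal , h-normal = h-normal , g-normal
Γ-normal (γ-comp p q)   with Γ-normal p | Γ-normal q
... | g , g⁻¹ | h , h⁻¹ = normal-∘ g h , normal-∘ h⁻¹ g⁻¹

lemma3p2 : (m : ℕ) → m ≥ 1 → ∀ {g h : X m → X m} → InΓ g h →
    Σ (Permutation′ m) λ ψ → Σ (Rel2 m) λ F →
    Symmetric F × (∀ (x : X m) → g x ≈X (αψ ψ ∘ αF F) x)
lemma3p2 m _ g∈Γ = proj₁ (Γ-normal g∈Γ)
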